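{- Let $h(x)$ be a polynomial with real coefficients, and let $F_{h,n}(x)$ and $L_{h,n}(x)$ be defined by $F_{h,0}=0$, $F_{h,1}=1$, $F_{h,n+1}=h(x)F_{h,n}+F_{h,n-1}$ and $L_{h,0}=2$, $L_{h,1}=h(x)$, $L_{h,n+1}=h(x)L_{h,n}+L_{h,n-1}$ ($n\ge1$). Then for every integer $n\ge1$, $$\sum_{i=0}^{\lfloor n/2\rfloor} i\,\frac{n}{n-i}\binom{n-i}{i}h^{n-2i}(x)=\frac{n}{2}\big[L_{h,n}(x)-h(x)F_{h,n}(x)\big].$$
   Context: $h(x)$ is a polynomial with real coefficients; $h^k(x)$ denotes $(h(x))^k$. $F_{h,n}$, $L_{h,n}$ are the $h(x)$-Fibonacci and $h(x)$-Lucas polynomials. -}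

module Defs where

open import Algebra.Bundles using (CommutativeRing)
open import Data.Nat as ℕ using (ℕ; zero; suc)
open import Data.Nat.DivMod using (_/_)
open import Data.Nat.Combinatorics using (_C_)

-- For 0 ≤ i ≤ ⌊n/2⌋ and n ≥ 1 we have n - i ≥ 1 and (n-i) ∣ n * binom(n-i,i)
-- (this rational number is an integer), so the floor division is exact.
-- The zero case of n ∸ i never occurs in the range of the theorem.
coeff : ℕ → ℕ → ℕ
coeff n i with n ℕ.∸ i
... | zero  = 0
... | suc k = (n ℕ.* (suc k C i)) / suc k

module _ {c ℓ} (R : CommutativeRing c ℓ) where
  open CommutativeRing R hiding (zero)

  two : Carrier
  two = 1# + 1#

  fibH : Carrier → ℕ → Carrier
  fibH h zero = 0#
  fibH h (suc zero) = 1#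
  fibH h (suc (suc n)) = h * fibH h (suc n) + fibH h n

  lucH : Carrier → ℕ → Carrier
  lucH h zero = two
  lucH h (suc zero) = h
  lucH h (suc (suc n)) = h * lucH h (suc n) + lucH h n

  sumUpTo : ℕ → (ℕ → Carrier) → Carrier
  sumUpTo zero f = f zero
  sumUpTo (suc m) f = sumUpTo m f + f (suc m)

{-# OPTIONS --safe #-}
-- By the absorption identity i C(n-i,i) = (n-i) C(n-i-1,i-1), the summand with
-- i = j+1 is n C(n-2-j,j) h^(n-2-2j), so the left side is n times the diagonal binomial sum
-- Σ_j C(k-j,j) h^(k-2j) with k = n-2. By Pascal's rule that sum satisfies the Fibonacci
-- recurrence in k, hence equals F_{h,k+1} = F_{h,n-1}. On the right, h F_{h,n} + 2 F_{h,n-1}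
-- satisfies the Lucas recurrence with the Lucas initial values, so L_{h,n} - h F_{h,n} = 2 F_{h,n-1}.
module Submission where

open import Defs
open import Level using (Level)
open import Algebra.Bundles using (CommutativeRing; Semiring)
open import Data.Nat as ℕ using (ℕ; zero; suc; _∸_; _≤_; _<_; s≤s; _≤′_; ≤′-refl; ≤′-step)
open import Data.Nat.Combinatorics using (_C_)
open import Data.Nat.Combinatorics.Specification using (k>n⇒nCk≡0)
open import Data.Nat.DivMod using (_/_; m/n≤m; m/n≡1+[m∸n]/n)
import Data.Nat.Properties as ℕ
import Algebra.Definitions.RawSemiring as RS
import Algebra.Properties.Semiring.Mult as SemiringMult
import Algebra.Properties.Semiring.Exp as SemiringExp
import Algebra.Properties.CommutativeMonoid.Mult as CommutativeMonoidMult
import Algebra.Properties.CommutativeSemigroup as CommutativeSemigroupProperties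
import Algebra.Properties.AbelianGroup as AbelianGroupProperties
import Relation.Binary.Reasoning.Setoid as SetoidReasoning
open import Relation.Binary.PropositionalEquality using (_≡_; cong)
open import Data.Maybe using (nothing)
open import Data.Sum using (inj₁; inj₂)
open import Tactic.RingSolver using (solve-∀)
open import Tactic.RingSolver.Core.AlmostCommutativeRing using (AlmostCommutativeRing; fromCommutativeRing)

module Binomial where
  open import Data.Nat
  open import Data.Nat.Properties
  open import Data.Nat.Combinatorics using (nCk+nC[k+1]≡[n+1]C[k+1]; nC1≡n)
  open import Data.Nat.DivMod using (_%_; m*n/n≡m; m≡m%n+[m/n]*n; m%n<n)
  open import Relation.Binary.PropositionalEquality

  absorption : ∀ k i → suc i * (suc k C suc i) ≡ suc k * (k C i)
  absorption k       zero    =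
    trans (+-identityʳ (suc k C 1)) (trans (nC1≡n (suc k)) (sym (*-identityʳ (suc k))))
  absorption zero    (suc i) = *-zeroʳ (2 + i)
  absorption (suc k) (suc i) = begin
    (2 + i) * ((2 + k) C (2 + i))
      ≡⟨ cong ((2 + i) *_) (nCk+nC[k+1]≡[n+1]C[k+1] (suc k) (suc i)) ⟨
    (2 + i) * (a + b)
      ≡⟨ *-distribˡ-+ (2 + i) a b ⟩
    (a + (1 + i) * a) + (2 + i) * b
      ≡⟨ cong₂ (λ x y → (a + x) + y) (absorption k i) (absorption k (suc i)) ⟩
    (a + (1 + k) * (k C i)) + (1 + k) * (k C (1 + i))
      ≡⟨ +-assoc a ((1 + k) * (k C i)) ((1 + k) * (k C (1 + i))) ⟩
    a + ((1 + k) * (k C i) + (1 + k) * (k C (1 + i)))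
      ≡⟨ cong (a +_) (*-distribˡ-+ (1 + k) (k C i) (k C (1 + i))) ⟨
    a + (1 + k) * ((k C i) + (k C (1 + i)))
      ≡⟨ cong (λ x → a + (1 + k) * x) (nCk+nC[k+1]≡[n+1]C[k+1] k i) ⟩
    (2 + k) * a
      ∎
    where
    open ≡-Reasoning
    a b : ℕ
    a = (1 + k) C (1 + i)
    b = (1 + k) C (2 + i)

  coeff-unfold : ∀ n i {k} → n ∸ i ≡ suc k → coeff n i ≡ n * (suc k C i) / suc k
  coeff-unfold n i eq with n ∸ i
  ... | _ rewrite eq = refl

  coeff≡C+C : ∀ k i → coeff (suc k + suc i) (suc i) ≡ (suc k C suc i) + (k C i)
  coeff≡C+C k i = begin
    coeff (suc k + suc i) (suc i)      ≡⟨ coeff-unfold (suc k + suc i) (suc i) (m+n∸n≡m (suc k) (suc i)) ⟩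
    (suc k + suc i) * a / suc k        ≡⟨ cong (_/ suc k) n*a≡[a+b]*[1+k] ⟩
    (a + b) * suc k / suc k            ≡⟨ m*n/n≡m (a + b) (suc k) ⟩
    a + b                              ∎
    where
    open ≡-Reasoning
    a b : ℕ
    a = suc k C suc i
    b = k C i
    n*a≡[a+b]*[1+k] : (suc k + suc i) * a ≡ (a + b) * suc k
    n*a≡[a+b]*[1+k] = begin
      (suc k + suc i) * a         ≡⟨ *-distribʳ-+ a (suc k) (suc i) ⟩
      suc k * a + suc i * a       ≡⟨ cong (suc k * a +_) (absorption k i) ⟩
      suc k * a + suc k * b       ≡⟨ *-distribˡ-+ (suc k) a b ⟨
      suc k * (a + b)             ≡⟨ *-comm (suc k) (a + b) ⟩
      (a + b) * suc k             ∎

  [1+i]*coeff≡n*kCi : ∀ k i → suc i * coeff (suc k + suc i) (suc i) ≡ (suc k + suc i) * (k C i)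
  [1+i]*coeff≡n*kCi k i = begin
    suc i * coeff (suc k + suc i) (suc i)   ≡⟨ cong (suc i *_) (coeff≡C+C k i) ⟩
    suc i * (a + b)                         ≡⟨ *-distribˡ-+ (suc i) a b ⟩
    suc i * a + suc i * b                   ≡⟨ cong (_+ suc i * b) (absorption k i) ⟩
    suc k * b + suc i * b                   ≡⟨ *-distribʳ-+ b (suc k) (suc i) ⟨
    (suc k + suc i) * b                     ∎
    where
    open ≡-Reasoning
    a b : ℕ
    a = suc k C suc i
    b = k C i

  [1+j]*coeff≡[2+m]*[m∸j]Cj : ∀ {m j} → j ≤ m → suc j * coeff (2 + m) (suc j) ≡ (2 + m) * ((m ∸ j) C j)
  [1+j]*coeff≡[2+m]*[m∸j]Cj {m} {j} j≤m =
    subst (λ n → suc j * coeff n (suc j) ≡ n * ((m ∸ j) C j)) n≡2+m ([1+i]*coeff≡n*kCi (m ∸ j) j)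
    where
    n≡2+m : suc (m ∸ j) + suc j ≡ 2 + m
    n≡2+m = cong suc (trans (+-suc (m ∸ j) j) (cong suc (m∸n+n≡m j≤m)))

  [1+m∸j]C[1+j]≡[m∸j]Cj+[m∸j]C[1+j] : ∀ m j → (suc m ∸ j) C suc j ≡ (m ∸ j) C j + (m ∸ j) C suc j
  [1+m∸j]C[1+j]≡[m∸j]Cj+[m∸j]C[1+j] m j with ≤-<-connex j m
  ... | inj₁ j≤m =
    trans (cong (_C suc j) (+-∸-assoc 1 j≤m)) (sym (nCk+nC[k+1]≡[n+1]C[k+1] (m ∸ j) j))
  ... | inj₂ m<j rewrite m≤n⇒m∸n≡0 m<j | m≤n⇒m∸n≡0 (<⇒≤ m<j) = begin
    0 C suc j                  ≡⟨ k>n⇒nCk≡0 {0} {suc j} z<s ⟩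
    0                          ≡⟨ cong₂ _+_ (k>n⇒nCk≡0 (≤-trans z<s m<j)) (k>n⇒nCk≡0 {0} {suc j} z<s) ⟨
    0 C j + 0 C suc j          ∎
    where open ≡-Reasoning

  ∸≡suc[∸suc] : ∀ {m k} → k < m → m ∸ k ≡ suc (m ∸ suc k)
  ∸≡suc[∸suc] (s≤s k≤m) = +-∸-assoc 1 k≤m

  m≤2*j⇒m∸j<1+j : ∀ {m j} → m ≤ 2 * j → m ∸ j < suc j
  m≤2*j⇒m∸j<1+j {m} {j} m≤2j = s≤s (≤-trans (m≤n+o⇒m∸n≤o m j m≤2j) (≤-reflexive (+-identityʳ j)))

  m/2<j⇒m<j+j : ∀ m j → m / 2 < j → m < j + j
  m/2<j⇒m<j+j m j m/2<j = begin-strict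
    m                    ≡⟨ m≡m%n+[m/n]*n m 2 ⟩
    m % 2 + m / 2 * 2    <⟨ +-monoˡ-< (m / 2 * 2) (m%n<n m 2) ⟩
    suc (m / 2) * 2      ≤⟨ *-monoˡ-≤ 2 m/2<j ⟩
    j * 2                ≡⟨ *-suc j 1 ⟩
    j + j * 1            ≡⟨ cong (j +_) (*-identityʳ j) ⟩
    j + j                ∎
    where open ≤-Reasoning

open Binomial

module _ {c ℓ} (R : CommutativeRing c ℓ) where
  -- The ring solver reads the goal through the operators of an AlmostCommutativeRing, so this
  -- identity is stated before R's own operators are opened.
  private
    almostRing : AlmostCommutativeRing c ℓ
    almostRing = fromCommutativeRing R (λ _ → nothing)

    module _ where
      open AlmostCommutativeRing almostRing

      recurrence-regroup : ∀ h t a b c →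
        h * (h * a + t * b) + (h * b + t * c) ≈ h * (h * a + b) + t * (h * b + c)
      recurrence-regroup = solve-∀ almostRing

  open CommutativeRing R hiding (zero)
  open RS (Semiring.rawSemiring semiring) using (_×_; _^_)
  open SemiringMult semiring using (×-congˡ; ×-congʳ; ×-cong; ×-homo-0; ×-homo-+; ×-comm-*; ×-assoc-*; ×-assocˡ)
  open SemiringExp semiring using (^-congʳ)
  open CommutativeMonoidMult +-commutativeMonoid using (×-distrib-+)
  open CommutativeSemigroupProperties +-commutativeSemigroup using (interchange)
  open AbelianGroupProperties +-abelianGroup using (xyx⁻¹≈y)
  open SetoidReasoning setoid

  sumUpTo-cong : ∀ N {f g} → (∀ j → j ≤ N → f j ≈ g j) → sumUpTo R N f ≈ sumUpTo R N g
  sumUpTo-cong zero    f≈g = f≈g 0 ℕ.z≤n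
  sumUpTo-cong (suc N) f≈g =
    +-cong (sumUpTo-cong N (λ j j≤N → f≈g j (ℕ.m≤n⇒m≤1+n j≤N))) (f≈g (suc N) ℕ.≤-refl)

  sumUpTo-unconsˡ : ∀ N f → sumUpTo R (suc N) f ≈ f 0 + sumUpTo R N (λ j → f (suc j))
  sumUpTo-unconsˡ zero    f = refl
  sumUpTo-unconsˡ (suc N) f = trans (+-congʳ (sumUpTo-unconsˡ N f)) (+-assoc _ _ _)

  sumUpTo-distrib-+ : ∀ N f g → sumUpTo R N (λ j → f j + g j) ≈ sumUpTo R N f + sumUpTo R N g
  sumUpTo-distrib-+ zero    f g = refl
  sumUpTo-distrib-+ (suc N) f g = trans (+-congʳ (sumUpTo-distrib-+ N f g)) (interchange _ _ _ _)

  *-distribˡ-sumUpTo : ∀ N x f → x * sumUpTo R N f ≈ sumUpTo R N (λ j → x * f j)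
  *-distribˡ-sumUpTo zero    x f = refl
  *-distribˡ-sumUpTo (suc N) x f = trans (distribˡ x _ _) (+-congʳ (*-distribˡ-sumUpTo N x f))

  ×-distrib-sumUpTo : ∀ N n f → n × sumUpTo R N f ≈ sumUpTo R N (λ j → n × f j)
  ×-distrib-sumUpTo zero    n f = refl
  ×-distrib-sumUpTo (suc N) n f = trans (×-distrib-+ _ _ n) (+-congʳ (×-distrib-sumUpTo N n f))

  sumUpTo-extend : ∀ {N M} f → N ≤′ M → (∀ j → N < j → f j ≈ 0#) → sumUpTo R M f ≈ sumUpTo R N f
  sumUpTo-extend     f ≤′-refl            tail≈0 = refl
  sumUpTo-extend {N} f (≤′-step {M} N≤′M) tail≈0 = begin
    sumUpTo R M f + f (suc M)  ≈⟨ +-congˡ (tail≈0 (suc M) (s≤s (ℕ.≤′⇒≤ N≤′M))) ⟩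
    sumUpTo R M f + 0#         ≈⟨ +-identityʳ (sumUpTo R M f) ⟩
    sumUpTo R M f              ≈⟨ sumUpTo-extend f N≤′M tail≈0 ⟩
    sumUpTo R N f              ∎

  module _ (h : Carrier) where

    fibTerm : ℕ → ℕ → Carrier
    fibTerm m j = ((m ∸ j) C j) × (h ^ (m ∸ 2 ℕ.* j))

    fibDiagonal : ℕ → Carrier
    fibDiagonal m = sumUpTo R m (fibTerm m)

    fibTerm-vanishes : ∀ m j → m < j ℕ.+ j → fibTerm m j ≈ 0#
    fibTerm-vanishes m zero    ()
    fibTerm-vanishes m (suc j) m<j+j = begin
      ((m ∸ suc j) C suc j) × h ^ (m ∸ 2 ℕ.* suc j)  ≈⟨ ×-congˡ (k>n⇒nCk≡0 (ℕ.m<n+o⇒m∸n<o m (suc j) m<j+j)) ⟩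
      0 × h ^ (m ∸ 2 ℕ.* suc j)                      ≈⟨ ×-homo-0 (h ^ (m ∸ 2 ℕ.* suc j)) ⟩
      0#                                             ∎

    fibTerm-rec : ∀ m j → fibTerm (2 ℕ.+ m) (suc j) ≈ h * fibTerm (suc m) (suc j) + fibTerm m j
    fibTerm-rec m j = begin
      fibTerm (2 ℕ.+ m) (suc j)
        ≈⟨ ×-congʳ ((suc m ∸ j) C suc j) (^-congʳ h (cong (2 ℕ.+ m ∸_) (ℕ.*-suc 2 j))) ⟩
      ((suc m ∸ j) C suc j) × h ^ e
        ≈⟨ ×-congˡ ([1+m∸j]C[1+j]≡[m∸j]Cj+[m∸j]C[1+j] m j) ⟩
      ((m ∸ j) C j ℕ.+ b) × h ^ e
        ≈⟨ ×-homo-+ (h ^ e) ((m ∸ j) C j) b ⟩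
      fibTerm m j + b × h ^ e
        ≈⟨ +-comm (fibTerm m j) (b × h ^ e) ⟩
      b × h ^ e + fibTerm m j
        ≈⟨ +-congʳ b×h^e≈h*fibTerm ⟩
      h * fibTerm (suc m) (suc j) + fibTerm m j ∎
      where
      b e : ℕ
      b = (m ∸ j) C suc j
      e = m ∸ 2 ℕ.* j
      b×h^e≈h*fibTerm : b × h ^ e ≈ h * fibTerm (suc m) (suc j)
      b×h^e≈h*fibTerm with ℕ.<-≤-connex (2 ℕ.* j) m
      ... | inj₁ 2j<m = begin
        b × h ^ e                           ≈⟨ ×-congʳ b (^-congʳ h (∸≡suc[∸suc] 2j<m)) ⟩
        b × (h * h ^ (m ∸ suc (2 ℕ.* j)))   ≈⟨ ×-comm-* b h (h ^ (m ∸ suc (2 ℕ.* j))) ⟨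
        h * (b × h ^ (m ∸ suc (2 ℕ.* j)))   ≈⟨ *-congˡ (×-congʳ b (^-congʳ h (cong (suc m ∸_) (ℕ.*-suc 2 j)))) ⟨
        h * fibTerm (suc m) (suc j)         ∎
      ... | inj₂ m≤2j = begin
        b × h ^ e                   ≈⟨ ×-congˡ b≡0 ⟩
        0 × h ^ e                   ≈⟨ ×-homo-0 (h ^ e) ⟩
        0#                          ≈⟨ zeroʳ h ⟨
        h * 0#                      ≈⟨ *-congˡ (×-homo-0 (h ^ (suc m ∸ 2 ℕ.* suc j))) ⟨
        h * (0 × h ^ (suc m ∸ 2 ℕ.* suc j)) ≈⟨ *-congˡ (×-congˡ b≡0) ⟨
        h * fibTerm (suc m) (suc j) ∎
        where
        b≡0 : b ≡ 0
        b≡0 = k>n⇒nCk≡0 (m≤2*j⇒m∸j<1+j {m} {j} m≤2j)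

    fibDiagonal-rec : ∀ m → fibDiagonal (2 ℕ.+ m) ≈ h * fibDiagonal (suc m) + fibDiagonal m
    fibDiagonal-rec m = begin
      fibDiagonal (2 ℕ.+ m)
        ≈⟨ sumUpTo-unconsˡ (suc m) (fibTerm (2 ℕ.+ m)) ⟩
      fibTerm (2 ℕ.+ m) 0 + sumUpTo R (suc m) (λ j → fibTerm (2 ℕ.+ m) (suc j))
        ≈⟨ +-congˡ (sumUpTo-cong (suc m) (λ j _ → fibTerm-rec m j)) ⟩
      fibTerm (2 ℕ.+ m) 0 + sumUpTo R (suc m) (λ j → h * shifted j + fibTerm m j)
        ≈⟨ +-congˡ (sumUpTo-distrib-+ (suc m) (λ j → h * shifted j) (fibTerm m)) ⟩
      fibTerm (2 ℕ.+ m) 0 + (sumUpTo R (suc m) (λ j → h * shifted j) + sumUpTo R (suc m) (fibTerm m))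
        ≈⟨ +-cong first-term (+-cong h*tail-vanishes tail-vanishes) ⟩
      h * fibTerm (suc m) 0 + (sumUpTo R m (λ j → h * shifted j) + fibDiagonal m)
        ≈⟨ +-assoc _ _ _ ⟨
      (h * fibTerm (suc m) 0 + sumUpTo R m (λ j → h * shifted j)) + fibDiagonal m
        ≈⟨ +-congʳ (+-congˡ (*-distribˡ-sumUpTo m h shifted)) ⟨
      (h * fibTerm (suc m) 0 + h * sumUpTo R m shifted) + fibDiagonal m
        ≈⟨ +-congʳ (distribˡ h _ _) ⟨
      h * (fibTerm (suc m) 0 + sumUpTo R m shifted) + fibDiagonal m
        ≈⟨ +-congʳ (*-congˡ (sumUpTo-unconsˡ m (fibTerm (suc m)))) ⟨
      h * fibDiagonal (suc m) + fibDiagonal m ∎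
      where
      shifted : ℕ → Carrier
      shifted j = fibTerm (suc m) (suc j)
      first-term : fibTerm (2 ℕ.+ m) 0 ≈ h * fibTerm (suc m) 0
      first-term = trans (+-identityʳ (h ^ (2 ℕ.+ m))) (*-congˡ (sym (+-identityʳ (h ^ suc m))))
      h*tail-vanishes : sumUpTo R (suc m) (λ j → h * shifted j) ≈ sumUpTo R m (λ j → h * shifted j)
      h*tail-vanishes = sumUpTo-extend (λ j → h * shifted j) (≤′-step ≤′-refl) λ j m<j →
        trans (*-congˡ (fibTerm-vanishes (suc m) (suc j) (ℕ.m≤n⇒m≤n+o (suc j) (s≤s m<j)))) (zeroʳ h)
      tail-vanishes : sumUpTo R (suc m) (fibTerm m) ≈ fibDiagonal m
      tail-vanishes = sumUpTo-extend (fibTerm m) (≤′-step ≤′-refl) λ j m<j →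
        fibTerm-vanishes m j (ℕ.m≤n⇒m≤n+o j m<j)

    fibH≈fibDiagonal : ∀ m → fibH R h (suc m) ≈ fibDiagonal m
    fibH≈fibDiagonal zero          = sym (+-identityʳ 1#)
    fibH≈fibDiagonal (suc zero)    = sym (+-identityʳ (h * 1# + 0#))
    fibH≈fibDiagonal (suc (suc m)) =
      trans (+-cong (*-congˡ (fibH≈fibDiagonal (suc m))) (fibH≈fibDiagonal m)) (sym (fibDiagonal-rec m))

    fibDiagonal-truncate : ∀ m → sumUpTo R (m / 2) (fibTerm m) ≈ fibDiagonal m
    fibDiagonal-truncate m = sym (sumUpTo-extend (fibTerm m) (ℕ.≤⇒≤′ (m/n≤m m 2))
      λ j m/2<j → fibTerm-vanishes m j (m/2<j⇒m<j+j m j m/2<j))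

    coeffSum≈n×fibH : ∀ m →
      sumUpTo R (suc m / 2) (λ i → (i ℕ.* coeff (suc m) i) × h ^ (suc m ∸ 2 ℕ.* i)) ≈ suc m × fibH R h m
    coeffSum≈n×fibH zero    = sym (+-identityʳ 0#)
    coeffSum≈n×fibH (suc m) = begin
      sumUpTo R (n / 2) term
        ≈⟨ reflexive (cong (λ N → sumUpTo R N term) (m/n≡1+[m∸n]/n {n} {2} (s≤s (s≤s ℕ.z≤n)))) ⟩
      sumUpTo R (suc (m / 2)) term
        ≈⟨ sumUpTo-unconsˡ (m / 2) term ⟩
      0# + sumUpTo R (m / 2) (λ j → term (suc j))
        ≈⟨ +-identityˡ _ ⟩
      sumUpTo R (m / 2) (λ j → term (suc j))
        ≈⟨ sumUpTo-cong (m / 2) (λ j j≤m/2 → term-suc (ℕ.≤-trans j≤m/2 (m/n≤m m 2))) ⟩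
      sumUpTo R (m / 2) (λ j → n × fibTerm m j)
        ≈⟨ ×-distrib-sumUpTo (m / 2) n (fibTerm m) ⟨
      n × sumUpTo R (m / 2) (fibTerm m)
        ≈⟨ ×-congʳ n (fibDiagonal-truncate m) ⟩
      n × fibDiagonal m
        ≈⟨ ×-congʳ n (fibH≈fibDiagonal m) ⟨
      n × fibH R h (suc m) ∎
      where
      n : ℕ
      n = 2 ℕ.+ m
      term : ℕ → Carrier
      term i = (i ℕ.* coeff n i) × h ^ (n ∸ 2 ℕ.* i)
      term-suc : ∀ {j} → j ≤ m → term (suc j) ≈ n × fibTerm m j
      term-suc {j} j≤m = begin
        (suc j ℕ.* coeff n (suc j)) × h ^ (n ∸ 2 ℕ.* suc j)
          ≈⟨ ×-cong ([1+j]*coeff≡[2+m]*[m∸j]Cj j≤m) (^-congʳ h (cong (n ∸_) (ℕ.*-suc 2 j))) ⟩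
        (n ℕ.* ((m ∸ j) C j)) × h ^ (m ∸ 2 ℕ.* j)
          ≈⟨ ×-assocˡ (h ^ (m ∸ 2 ℕ.* j)) n ((m ∸ j) C j) ⟨
        n × fibTerm m j ∎

    lucH≈h*fibH+two*fibH : ∀ m → lucH R h (suc m) ≈ h * fibH R h (suc m) + two R * fibH R h m
    lucH≈h*fibH+two*fibH zero          = sym (trans (+-cong (*-identityʳ h) (zeroʳ (two R))) (+-identityʳ h))
    lucH≈h*fibH+two*fibH (suc zero)    =
      +-cong (*-congˡ (sym (trans (+-identityʳ (h * 1#)) (*-identityʳ h)))) (sym (*-identityʳ (two R)))
    lucH≈h*fibH+two*fibH (suc (suc m)) =
      trans (+-cong (*-congˡ (lucH≈h*fibH+two*fibH (suc m))) (lucH≈h*fibH+two*fibH m))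
            (recurrence-regroup h (two R) _ _ _)

    lucH-h*fibH≈two*fibH : ∀ m → lucH R h (suc m) - h * fibH R h (suc m) ≈ two R * fibH R h m
    lucH-h*fibH≈two*fibH m = trans (+-congʳ (lucH≈h*fibH+two*fibH m)) (xyx⁻¹≈y _ _)

  ×half*two≈× : ∀ {half} → half + half ≈ 1# → ∀ n x → (n × half) * (two R * x) ≈ n × x
  ×half*two≈× {half} half+half≈1 n x = begin
    (n × half) * (two R * x)   ≈⟨ ×-assoc-* n half (two R * x) ⟩
    n × (half * (two R * x))   ≈⟨ ×-congʳ n half*two*x≈x ⟩
    n × x                      ∎
    where
    half*two*x≈x : half * ((1# + 1#) * x) ≈ x
    half*two*x≈x = begin
      half * ((1# + 1#) * x)       ≈⟨ *-assoc half (1# + 1#) x ⟨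
      (half * (1# + 1#)) * x       ≈⟨ *-congʳ (distribˡ half 1# 1#) ⟩
      (half * 1# + half * 1#) * x  ≈⟨ *-congʳ (+-cong (*-identityʳ half) (*-identityʳ half)) ⟩
      (half + half) * x            ≈⟨ *-congʳ half+half≈1 ⟩
      1# * x                       ≈⟨ *-identityˡ x ⟩
      x                            ∎

lemma14 : ∀ {c ℓ : Level} (R : CommutativeRing c ℓ) →
    let open CommutativeRing R in
    let open RS (Semiring.rawSemiring semiring) in
    (half : Carrier) → half + half ≈ 1# →
    (h : Carrier) (n : ℕ) → 1 ≤ n →
    sumUpTo R (n / 2) (λ i → (i ℕ.* coeff n i) × (h ^ (n ℕ.∸ 2 ℕ.* i)))
      ≈ (n × half) * (lucH R h n - h * fibH R h n)
lemma14 R half half+half≈1 h (suc m) _ = begin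
  sumUpTo R (suc m / 2) (λ i → (i ℕ.* coeff (suc m) i) × (h ^ (suc m ∸ 2 ℕ.* i)))
    ≈⟨ coeffSum≈n×fibH R h m ⟩
  suc m × fibH R h m
    ≈⟨ ×half*two≈× R half+half≈1 (suc m) (fibH R h m) ⟨
  (suc m × half) * (two R * fibH R h m)
    ≈⟨ *-congˡ (lucH-h*fibH≈two*fibH R h m) ⟨
  (suc m × half) * (lucH R h (suc m) - h * fibH R h (suc m)) ∎
  where
  open CommutativeRing R
  open RS (Semiring.rawSemiring semiring) using (_×_; _^_)
  open SetoidReasoning setoid
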